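{- For each positive integer $k$ there exists a constant $n_k$ such that for every integer $n \geqslant n_k$ (with $n>1$), the set $\mathcal{A}(n) = \{a \in \mathbb{Z}^{+} : a < n,\ \gcd(a,n) = 1\}$ contains an arithmetic progression of length $k$.
   Context: An arithmetic progression of length $k$ is a sequence of $k$ integers $a_0, a_0+q, a_0+2q, \dots, a_0+(k-1)q$ with common difference $q$ a positive integer. -}

module Defs where

open import Data.Nat using (ℕ; _+_; _*_; _<_)
open import Data.Nat.GCD using (gcd)
open import Data.Product using (Σ; _×_)
open import Data.Fin using (Fin; toℕ)
open import Relation.Binary.PropositionalEquality using (_≡_)

InA : ℕ → ℕ → Set
InA n a = (0 < a) × (a < n) × (gcd a n ≡ 1)

ContainsAP : ℕ → ℕ → Set
ContainsAP k n =
  Σ ℕ λ a₀ → Σ ℕ λ q → (0 < q) × ((i : Fin k) → InA n (a₀ + toℕ i * q))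

{-# OPTIONS --safe #-}
-- If every prime factor of n is below 2k, the progression 1 + i·(2k)! works: each term is 1
-- modulo every prime factor of n. Otherwise n = m·p with p ≥ 2k prime, and we take a progression
-- of difference m; it stays below n because k < p, and its terms are coprime to m when it starts
-- at 1 or at m − 1. As for p: if p divides some 1 + j·m, it divides no (m − 1) + i·m, since the
-- sum of these two terms is (1 + i + j)·m with 0 < 1 + i + j < p and p ∤ m.
module Submission where

open import Defs
open import Data.Nat using (ℕ; _<_; _≤_)
open import Data.Product using (Σ; ∃-syntax; _×_; _,_)

open import Data.Nat.Base using (zero; suc; _+_; _*_; _!; _>_; z≤n; s≤s; NonZero; >-nonZero)
open import Data.Nat.Properties
open import Data.Nat.Divisibility
open import Data.Nat.GCD using (gcd)
open import Data.Nat.Coprimality using (coprime⇒gcd≡1)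
open import Data.Nat.Primality
  using (Prime; prime?; ¬prime[1]; prime⇒nonZero; euclidsLemma; prime⇒irreducible)
open import Data.Nat.Primality.Factorisation using (factorise)
open import Data.Nat.ListAction using (product)
open import Data.Nat.Tactic.RingSolver using (solve-∀)
open import Data.List.Base using ([]; _∷_)
open import Data.List.Relation.Unary.All using (_∷_)
open import Data.Fin.Base using (toℕ)
open import Data.Fin.Properties using (toℕ<n)
open import Data.Sum using (_⊎_; inj₁; inj₂; [_,_]′)
open import Data.Empty using (⊥; ⊥-elim)
open import Function.Base using (case_of_)
open import Relation.Nullary using (yes; no; contradiction)
open import Relation.Nullary.Decidable using (_×-dec_)
open import Relation.Binary.PropositionalEquality using (_≡_; refl; sym; subst)

NoCommonPrimeFactor : ℕ → ℕ → Set
NoCommonPrimeFactor a n = ∀ {p} → Prime p → p ∣ a → p ∣ n → ⊥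

noCommonPrimeFactor⇒gcd≡1 : ∀ {a n} → 0 < n → NoCommonPrimeFactor a n → gcd a n ≡ 1
noCommonPrimeFactor⇒gcd≡1 {a} {n} 0<n noCommon =
  coprime⇒gcd≡1 λ (d∣a , d∣n) → commonDivisor≡1 _ d∣a d∣n
  where
  commonDivisor≡1 : ∀ d → d ∣ a → d ∣ n → d ≡ 1
  commonDivisor≡1 zero _ 0∣n = contradiction (0∣⇒≡0 0∣n) (>⇒≢ 0<n)
  commonDivisor≡1 d@(suc _) d∣a d∣n with factorise d
  ... | record { factors = [] ; isFactorisation = d≡1 } = d≡1
  ... | record { factors = p ∷ ps ; isFactorisation = d≡p*Πps ; factorsPrime = p-prime ∷ _ } =
    ⊥-elim (noCommon p-prime (∣-trans p∣d d∣a) (∣-trans p∣d d∣n))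
    where
    p∣d : p ∣ d
    p∣d = subst (p ∣_) (sym d≡p*Πps) (m∣m*n (product ps))

prime∤1 : ∀ {p} → Prime p → p ∤ 1
prime∤1 p-prime p∣1 = ¬prime[1] (subst Prime (∣1⇒≡1 p∣1) p-prime)

∤⇒>0 : ∀ {d n} → d ∤ n → n > 0
∤⇒>0 {d} {zero}  d∤0 = contradiction (d ∣0) d∤0
∤⇒>0 {d} {suc _} _   = s≤s z≤n

∣m+n*o∣o⇒∣m : ∀ {d m} n {o} → d ∣ m + n * o → d ∣ o → d ∣ m
∣m+n*o∣o⇒∣m {d} {m} n {o} d∣m+n*o d∣o =
  ∣m+n∣m⇒∣n (subst (d ∣_) (+-comm m (n * o)) d∣m+n*o) (∣-trans d∣o (n∣m*n n))

∣! : ∀ {m n} .{{_ : NonZero m}} → m ≤ n → m ∣ n !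
∣! {suc m} m≤n = ∣-trans (m∣m*n (m !)) (m≤n⇒m!∣n! m≤n)

primeFactor≥? : ∀ b n → 0 < n →
  (∃[ p ] Prime p × b ≤ p × p ∣ n) ⊎ (∀ {p} → Prime p → p ∣ n → p < b)
primeFactor≥? b n 0<n
  with anyUpTo? (λ p → prime? p ×-dec b ≤? p ×-dec p ∣? n) (suc n)
... | yes (p , _ , large) = inj₁ (p , large)
... | no noLarge = inj₂ small
  where
  small : ∀ {p} → Prime p → p ∣ n → p < b
  small {p} p-prime p∣n with b ≤? p
  ... | no b≰p = ≰⇒> b≰p
  ... | yes b≤p = ⊥-elim (noLarge (p , s≤s (∣⇒≤ {{>-nonZero 0<n}} p∣n) , p-prime , b≤p , p∣n))

progression<n : ∀ {a q k n i} → a ≤ q → k * q < n → i < k → a + i * q < n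
progression<n {a} {q} {k} {n} {i} a≤q kq<n i<k = begin-strict
  a + i * q    ≤⟨ +-monoˡ-≤ (i * q) a≤q ⟩
  suc i * q    ≤⟨ *-monoˡ-≤ q i<k ⟩
  k * q        <⟨ kq<n ⟩
  n            ∎
  where open ≤-Reasoning

progression⇒containsAP : ∀ {k n} a q → 0 < a → a ≤ q → k * q < n →
  (∀ {i} → i < k → NoCommonPrimeFactor (a + i * q) n) → ContainsAP k n
progression⇒containsAP a q 0<a a≤q kq<n noCommon =
  a , q , <-≤-trans 0<a a≤q , λ i →
    <-≤-trans 0<a (m≤m+n a (toℕ i * q)) ,
    progression<n a≤q kq<n (toℕ<n i) ,
    noCommonPrimeFactor⇒gcd≡1 (≤-<-trans z≤n kq<n) (noCommon (toℕ<n i))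

noCommonPrimeFactor-+* : ∀ {a m} i → NoCommonPrimeFactor a m → NoCommonPrimeFactor (a + i * m) m
noCommonPrimeFactor-+* i a⊥m q-prime q∣a+im q∣m = a⊥m q-prime (∣m+n*o∣o⇒∣m i q∣a+im q∣m) q∣m

noCommonPrimeFactor-*prime : ∀ {a m p} → Prime p → p ∤ a →
  NoCommonPrimeFactor a m → NoCommonPrimeFactor a (m * p)
noCommonPrimeFactor-*prime {m = m} {p} p-prime p∤a a⊥m q-prime q∣a q∣mp
  with euclidsLemma m p q-prime q∣mp
... | inj₁ q∣m = a⊥m q-prime q∣a q∣m
... | inj₂ q∣p with prime⇒irreducible p-prime q∣p
...   | inj₁ refl = ¬prime[1] q-prime
...   | inj₂ refl = p∤a q∣a

smooth⇒containsAP : ∀ {b k n} → (∀ {p} → Prime p → p ∣ n → p < b) → k * b ! < n → ContainsAP k n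
smooth⇒containsAP {b} smooth kb!<n =
  progression⇒containsAP 1 (b !) ≤-refl (1≤n! b) kb!<n λ {i} _ p-prime p∣1+ib! p∣n →
    prime∤1 p-prime (∣m+n*o∣o⇒∣m i p∣1+ib! (∣! {{prime⇒nonZero p-prime}} (<⇒≤ (smooth p-prime p∣n))))

∣1+j*m⇒∤m-1+i*m : ∀ {k p m' i j} → Prime p → k + k ≤ p → i < k → j < k →
  p ∣ 1 + j * suc m' → p ∤ m' + i * suc m'
∣1+j*m⇒∤m-1+i*m {p = p} {m'} {i} {j} p-prime 2k≤p i<k j<k p∣1+jm p∣m'+im =
  [ p∤1+i+j , p∤m ]′ (euclidsLemma (suc (i + j)) (suc m') p-prime p∣[1+i+j]m)
  where
  sumOfTerms : ∀ m' i j → (m' + i * suc m') + (1 + j * suc m') ≡ suc (i + j) * suc m'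
  sumOfTerms = solve-∀
  p∣[1+i+j]m : p ∣ suc (i + j) * suc m'
  p∣[1+i+j]m = subst (p ∣_) (sumOfTerms m' i j) (∣m∣n⇒∣m+n p∣m'+im p∣1+jm)
  p∤1+i+j : p ∤ suc (i + j)
  p∤1+i+j p∣1+i+j = <⇒≱ (<-≤-trans (+-mono-≤-< i<k j<k) 2k≤p) (∣⇒≤ p∣1+i+j)
  p∤m : p ∤ suc m'
  p∤m p∣m = prime∤1 p-prime (∣m+n*o∣o⇒∣m j p∣1+jm p∣m)

k*m<m*p : ∀ {k m p} .{{_ : NonZero m}} → k < p → k * m < m * p
k*m<m*p {k} {m} {p} k<p = subst (k * m <_) (*-comm p m) (*-monoˡ-< m k<p)

noCommonPrimeFactor-suc : ∀ n → NoCommonPrimeFactor n (suc n)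
noCommonPrimeFactor-suc n {q} q-prime q∣n q∣1+n =
  prime∤1 q-prime (∣m+n∣m⇒∣n (subst (q ∣_) (+-comm 1 n) q∣1+n) q∣n)

avoidingStart : ∀ {k p} → Prime p → 0 < k → k + k ≤ p → ∀ m' →
  ∃[ a ] 0 < a × a ≤ suc m' × NoCommonPrimeFactor a (suc m') × (∀ {i} → i < k → p ∤ a + i * suc m')
avoidingStart {k} {p} p-prime 0<k 2k≤p m' with anyUpTo? (λ j → p ∣? 1 + j * suc m') k
... | no noHit =
  1 , s≤s z≤n , s≤s z≤n , (λ q-prime q∣1 _ → prime∤1 q-prime q∣1) , λ i<k p∣1+im → noHit (_ , i<k , p∣1+im)
... | yes (j , j<k , p∣1+jm) = m' , m'>0 , n≤1+n m' , noCommonPrimeFactor-suc m' , avoids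
  where
  avoids : ∀ {i} → i < k → p ∤ m' + i * suc m'
  avoids i<k = ∣1+j*m⇒∤m-1+i*m p-prime 2k≤p i<k j<k p∣1+jm
  m'>0 : 0 < m'
  m'>0 = ∤⇒>0 (subst (p ∤_) (+-identityʳ m') (avoids 0<k))

primeFactor⇒containsAP : ∀ {k n p} → 0 < k → 0 < n → Prime p → k + k ≤ p → p ∣ n → ContainsAP k n
primeFactor⇒containsAP _ () _ _ (divides-refl zero)
primeFactor⇒containsAP {k} 0<k _ p-prime 2k≤p (divides-refl (suc m')) =
  let a , 0<a , a≤m , a⊥m , avoids = avoidingStart p-prime 0<k 2k≤p m' in
  progression⇒containsAP a (suc m') 0<a a≤m (k*m<m*p (<-≤-trans (m<m+n k 0<k) 2k≤p)) λ {i} i<k →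
    noCommonPrimeFactor-*prime p-prime (avoids i<k) (noCommonPrimeFactor-+* i a⊥m)

lemma2p2 : (k : ℕ) → 0 < k →
    Σ ℕ λ nₖ → (n : ℕ) → nₖ ≤ n → 1 < n → ContainsAP k n
lemma2p2 k 0<k = suc (k * (k + k) !) , λ n nₖ≤n _ →
  let 0<n = <-≤-trans (s≤s z≤n) nₖ≤n in
  case primeFactor≥? (k + k) n 0<n of λ where
    (inj₁ (p , p-prime , 2k≤p , p∣n)) → primeFactor⇒containsAP 0<k 0<n p-prime 2k≤p p∣n
    (inj₂ smooth) → smooth⇒containsAP smooth nₖ≤n
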